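{- Let $G$ be a graph with no induced $P_7$, $C_4$ or $C_6$, and let $(B_1,\dots,B_5)$ be a nice blowup of $C_5$ in $G$. Then: (1) for each $i$, the vertices of $B_i$ can be ordered $b_i^1,\dots,b_i^{|B_i|}$ so that $N(b_i^1)\cap(B_{i-1}\cup B_{i+1})\subseteq N(b_i^2)\cap(B_{i-1}\cup B_{i+1})\subseteq\cdots\subseteq N(b_i^{|B_i|})\cap(B_{i-1}\cup B_{i+1})$; (2) for each $i$ there is a vertex of $B_i$ adjacent to every vertex of $B_{i-1}\cup B_{i+1}$; in particular every vertex of $B_{i-1}$ and every vertex of $B_{i+1}$ have a common neighbor in $B_i$.
   Context: Indices are modulo $5$. A tuple $(B_1,\dots,B_5)$ of pairwise disjoint nonempty vertex sets is a nice blowup of $C_5$ in $G$ if: each $B_i$ is a clique; every $v\in B_i$ has a neighbor in $B_{i-1}$ and a neighbor in $B_{i+1}$; there are no edges between $B_i$ and $B_{i+2}$ for every $i$; and for every $i$, $a\in B_i$, distinct $b,c\in B_{i+1}$, and $d\in B_{i+2}$, $G[\{a,b,c,d\}]$ is not an induced $P_4$. -}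

module Defs where

open import Data.Bool using (Bool; true; false; _∨_)
open import Data.Nat using (ℕ; zero; suc; _+_; _%_; _≡ᵇ_)
open import Data.Fin using (Fin; zero; suc; toℕ; _≤_)
open import Data.Fin.Subset using (Subset; _∈_; Nonempty; ∣_∣)
open import Data.Product using (Σ; ∃; _×_; _,_)
open import Data.Sum using (_⊎_)
open import Data.Empty using (⊥)
open import Relation.Nullary using (¬_)
open import Relation.Binary.PropositionalEquality using (_≡_; _≢_)
open import Function.Definitions using (Injective)

record Graph : Set where
  field
    n      : ℕ
    adj    : Fin n → Fin n → Bool
    sym    : ∀ u v → adj u v ≡ adj v u
    irrefl : ∀ v → adj v v ≡ false

open Graph public

Vertex : Graph → Set
Vertex G = Fin (n G)

Adj : (G : Graph) → Vertex G → Vertex G → Set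
Adj G u v = adj G u v ≡ true

pathAdj : (k : ℕ) → Fin k → Fin k → Bool
pathAdj k i j = ((toℕ i + 1) ≡ᵇ toℕ j) ∨ ((toℕ j + 1) ≡ᵇ toℕ i)

-- Adjacency of the cycle C_{m+1} on vertices 0,…,m (indices mod m+1).
cycleAdj : (m : ℕ) → Fin (suc m) → Fin (suc m) → Bool
cycleAdj m i j = (((toℕ i + 1) % suc m) ≡ᵇ toℕ j) ∨ (((toℕ j + 1) % suc m) ≡ᵇ toℕ i)

IsInducedCopy : (G : Graph) {k : ℕ} → (Fin k → Fin k → Bool) → (Fin k → Vertex G) → Set
IsInducedCopy G h f = Injective _≡_ _≡_ f × (∀ i j → adj G (f i) (f j) ≡ h i j)

HasInduced : (G : Graph) {k : ℕ} → (Fin k → Fin k → Bool) → Set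
HasInduced G {k} h = ∃ λ (f : Fin k → Vertex G) → IsInducedCopy G h f

P7 P4 : Σ ℕ λ k → (Fin k → Fin k → Bool)
P7 = 7 , pathAdj 7
P4 = 4 , pathAdj 4

C4 C6 : Σ ℕ λ k → (Fin k → Fin k → Bool)
C4 = 4 , cycleAdj 3
C6 = 6 , cycleAdj 5

Free : (G : Graph) → Σ ℕ (λ k → (Fin k → Fin k → Bool)) → Set
Free G (k , h) = ¬ HasInduced G h

-- G[{a,b,c,d}] is an induced P4: some induced copy of P4 has image inside {a,b,c,d}
-- (when a,b,c,d are distinct, injectivity makes the image exactly {a,b,c,d}).
InducedP4On : (G : Graph) → (a b c d : Vertex G) → Set
InducedP4On G a b c d =
  ∃ λ (f : Fin 4 → Vertex G) → IsInducedCopy G (pathAdj 4) f ×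
    (∀ t → f t ≡ a ⊎ f t ≡ b ⊎ f t ≡ c ⊎ f t ≡ d)

next : Fin 5 → Fin 5
next zero = suc zero
next (suc zero) = suc (suc zero)
next (suc (suc zero)) = suc (suc (suc zero))
next (suc (suc (suc zero))) = suc (suc (suc (suc zero)))
next (suc (suc (suc (suc zero)))) = zero

prev : Fin 5 → Fin 5
prev zero = suc (suc (suc (suc zero)))
prev (suc zero) = zero
prev (suc (suc zero)) = suc zero
prev (suc (suc (suc zero))) = suc (suc zero)
prev (suc (suc (suc (suc zero)))) = suc (suc (suc zero))

record NiceBlowup (G : Graph) (B : Fin 5 → Subset (n G)) : Set where
  field
    disjoint  : ∀ i j → i ≢ j → ∀ v → v ∈ B i → v ∈ B j → ⊥
    nonempty  : ∀ i → Nonempty (B i)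
    clique    : ∀ i u v → u ∈ B i → v ∈ B i → u ≢ v → Adj G u v
    nbrPrev   : ∀ i v → v ∈ B i → ∃ λ u → u ∈ B (prev i) × Adj G v u
    nbrNext   : ∀ i v → v ∈ B i → ∃ λ u → u ∈ B (next i) × Adj G v u
    noEdge    : ∀ i u v → u ∈ B i → v ∈ B (next (next i)) → ¬ Adj G u v
    noP4      : ∀ i a b c d → a ∈ B i → b ∈ B (next i) → c ∈ B (next i) → b ≢ c →
                d ∈ B (next (next i)) → ¬ InducedP4On G a b c d

InNbrs : (G : Graph) → (Fin 5 → Subset (n G)) → Fin 5 → Vertex G → Set
InNbrs G B i u = u ∈ B (prev i) ⊎ u ∈ B (next i)

IsOrdering : (G : Graph) (S : Subset (n G)) → (Fin ∣ S ∣ → Vertex G) → Set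
IsOrdering G S b = Injective _≡_ _≡_ b × (∀ v → v ∈ S → ∃ λ j → b j ≡ v) × (∀ j → b j ∈ S)

{-# OPTIONS --safe #-}
-- For u, v ∈ B_i write u ⊑ v when N(u) ∩ X ⊆ N(v) ∩ X, where X = B_{i-1} ∪ B_{i+1}.
-- This preorder is total on B_i: if u and v had exclusive neighbours w and w′ in X,
-- then u w w′ v would be an induced C4 when w, w′ lie in the same block, and
-- w u v w′ (or w′ v u w) an induced P4 excluded by niceness when they lie in
-- opposite blocks. Sorting B_i along ⊑ gives (1). A ⊑-greatest vertex of B_i gives
-- (2), because every vertex of X has some neighbour in B_i.

module Submission where

open import Defs hiding (sym)
open import Data.Bool using (true)
open import Data.Bool.Properties using (¬-not) renaming (_≟_ to _≟ᵇ_)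
open import Data.Fin using (Fin; _≤_; zero; suc)
open import Data.Fin.Patterns using (0F; 1F; 2F; 3F; 4F)
open import Data.Fin.Properties using (any?) renaming (_≟_ to _≟ᶠ_)
open import Data.Fin.Subset using (Subset; _∈_; _∉_; ∣_∣; _-_; Nonempty; inside; outside)
open import Data.Fin.Subset.Properties
  using (_∈?_; nonempty?; p─⊥≡p; p─q⊆p; x∈p∧x≢y⇒x∈p-y; x∈p⇒∣p-x∣<∣p∣)
open import Data.Nat as ℕ using (_<_; s≤s)
open import Data.Nat.Induction using (<-wellFounded)
open import Data.Nat.Properties using (suc-injective)
open import Data.Product using (∃; _×_; _,_)
open import Data.Sum using (_⊎_; inj₁; inj₂; swap)
open import Data.Vec using (lookup; _∷_; []; here; there)
open import Data.Vec.Relation.Unary.All using (_∷_; [])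
open import Data.Vec.Relation.Unary.AllPairs using (_∷_; [])
open import Data.Vec.Relation.Unary.Unique.Propositional using (Unique)
open import Data.Vec.Relation.Unary.Unique.Propositional.Properties using (lookup-injective)
import Data.Vec.Functional as Vector
open import Data.Empty using (⊥; ⊥-elim)
open import Function using (_∘_; flip)
open import Function.Definitions using (Injective)
open import Induction.WellFounded using (Acc; acc)
open import Relation.Binary using (Rel; Reflexive; Transitive)
open import Relation.Binary.PropositionalEquality using (_≡_; _≢_; refl; sym; trans; cong; subst)
open import Relation.Nullary using (¬_; Dec; yes; no; contradiction; ¬?)
open import Relation.Nullary.Decidable using (_×-dec_; _⊎-dec_; decidable-stable)

x∈p⇒∣p∣≡1+∣p-x∣ : ∀ {n} {p : Subset n} {x} → x ∈ p → ∣ p ∣ ≡ ℕ.suc ∣ p - x ∣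
x∈p⇒∣p∣≡1+∣p-x∣ {p = inside ∷ p}  here        = cong (ℕ.suc ∘ ∣_∣) (sym (p─⊥≡p p))
x∈p⇒∣p∣≡1+∣p-x∣ {p = inside ∷ p}  (there x∈p) = cong ℕ.suc (x∈p⇒∣p∣≡1+∣p-x∣ x∈p)
x∈p⇒∣p∣≡1+∣p-x∣ {p = outside ∷ p} (there x∈p) = x∈p⇒∣p∣≡1+∣p-x∣ x∈p

x∉p-x : ∀ {n} {p : Subset n} {x} → x ∉ p - x
x∉p-x {p = _ ∷ _} {x = zero}  ()
x∉p-x {p = _ ∷ _} {x = suc _} (there x∈p-x) = x∉p-x x∈p-x

x∈p-y⇒x≢y : ∀ {n} {p : Subset n} {x y} → x ∈ p - y → x ≢ y
x∈p-y⇒x≢y x∈p-x refl = x∉p-x x∈p-x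

∣p∣≡1+k⇒Nonempty : ∀ {n k} {p : Subset n} → ∣ p ∣ ≡ ℕ.suc k → Nonempty p
∣p∣≡1+k⇒Nonempty {p = inside ∷ _}  _ = zero , here
∣p∣≡1+k⇒Nonempty {p = outside ∷ _} eq with ∣p∣≡1+k⇒Nonempty eq
... | x , x∈p = suc x , there x∈p

∣p∣≡0⇒x∉p : ∀ {n} {p : Subset n} {x} → ∣ p ∣ ≡ 0 → x ∉ p
∣p∣≡0⇒x∉p eq x∈p with () ← trans (sym eq) (x∈p⇒∣p∣≡1+∣p-x∣ x∈p)

module PreorderOnSubset {n ℓ} (_≲_ : Rel (Fin n) ℓ)
                        (≲-refl : Reflexive _≲_) (≲-trans : Transitive _≲_) where

  TotalOn : Subset n → Set ℓ
  TotalOn S = ∀ {u v} → u ∈ S → v ∈ S → u ≲ v ⊎ v ≲ u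

  LowerBound : Subset n → Fin n → Set ℓ
  LowerBound S m = ∀ {v} → v ∈ S → m ≲ v

  Least : Subset n → Set ℓ
  Least S = ∃ λ m → m ∈ S × LowerBound S m

  TotalOn-remove : ∀ {S x} → TotalOn S → TotalOn (S - x)
  TotalOn-remove tot u∈ v∈ = tot (p─q⊆p _ _ u∈) (p─q⊆p _ _ v∈)

  LowerBound-insert : ∀ {S x m} → m ≲ x → LowerBound (S - x) m → LowerBound S m
  LowerBound-insert {x = x} m≲x lb {v} v∈S with v ≟ᶠ x
  ... | yes refl = m≲x
  ... | no  v≢x  = lb (x∈p∧x≢y⇒x∈p-y v∈S v≢x)

  least-acc : ∀ {S x} → Acc _<_ ∣ S ∣ → TotalOn S → x ∈ S → Least S
  least-acc {S} {x} (acc rec) tot x∈S with nonempty? (S - x)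
  ... | no  S-x-empty = x , x∈S , LowerBound-insert ≲-refl (λ v∈ → ⊥-elim (S-x-empty (_ , v∈)))
  ... | yes (_ , y∈S-x) with least-acc (rec (x∈p⇒∣p-x∣<∣p∣ x∈S)) (TotalOn-remove tot) y∈S-x
  ...   | m , m∈S-x , m-lb with tot x∈S (p─q⊆p _ _ m∈S-x)
  ...     | inj₁ x≲m = x , x∈S , LowerBound-insert ≲-refl (λ v∈ → ≲-trans x≲m (m-lb v∈))
  ...     | inj₂ m≲x = m , p─q⊆p _ _ m∈S-x , LowerBound-insert m≲x m-lb

  least : ∀ {S} → TotalOn S → Nonempty S → Least S
  least tot (_ , x∈S) = least-acc (<-wellFounded _) tot x∈S

  Enumeration : ∀ {k} → Subset n → (Fin k → Fin n) → Set
  Enumeration S b = Injective _≡_ _≡_ b × (∀ v → v ∈ S → ∃ λ j → b j ≡ v) × (∀ j → b j ∈ S)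

  Sorted : ∀ {k} → (Fin k → Fin n) → Set ℓ
  Sorted b = ∀ j k → j ≤ k → b j ≲ b k

  Enumeration-∷ : ∀ {k S m} {b : Fin k → Fin n} →
                  m ∈ S → Enumeration (S - m) b → Enumeration S (m Vector.∷ b)
  Enumeration-∷ {S = S} {m} {b} m∈S (inj , onto , into) = inj′ , onto′ , into′
    where
    inj′ : Injective _≡_ _≡_ (m Vector.∷ b)
    inj′ {zero}  {zero}  _   = refl
    inj′ {zero}  {suc j} m≡  = contradiction (sym m≡) (x∈p-y⇒x≢y (into j))
    inj′ {suc i} {zero}  ≡m  = contradiction ≡m (x∈p-y⇒x≢y (into i))
    inj′ {suc i} {suc j} b≡b = cong suc (inj b≡b)

    onto′ : ∀ v → v ∈ S → ∃ λ j → (m Vector.∷ b) j ≡ v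
    onto′ v v∈S with v ≟ᶠ m
    ... | yes refl = zero , refl
    ... | no  v≢m  with onto v (x∈p∧x≢y⇒x∈p-y v∈S v≢m)
    ...   | j , bj≡v = suc j , bj≡v

    into′ : ∀ j → (m Vector.∷ b) j ∈ S
    into′ zero    = m∈S
    into′ (suc j) = p─q⊆p _ _ (into j)

  Sorted-∷ : ∀ {k m} {b : Fin k → Fin n} → (∀ j → m ≲ b j) → Sorted b → Sorted (m Vector.∷ b)
  Sorted-∷ m≲b sorted zero    zero    _         = ≲-refl
  Sorted-∷ m≲b sorted zero    (suc j) _         = m≲b j
  Sorted-∷ m≲b sorted (suc i) (suc j) (s≤s i≤j) = sorted i j i≤j

  sortedEnumeration-of-size : ∀ k {S} → ∣ S ∣ ≡ k → TotalOn S →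
                              ∃ λ (b : Fin k → Fin n) → Enumeration S b × Sorted b
  sortedEnumeration-of-size 0 ∣S∣≡0 _ =
    Vector.[] , ((λ { {()} }) , (λ _ v∈S → contradiction v∈S (∣p∣≡0⇒x∉p ∣S∣≡0)) , (λ ())) , (λ ())
  sortedEnumeration-of-size (ℕ.suc k) ∣S∣≡1+k tot
    with m , m∈S , m-lb ← least tot (∣p∣≡1+k⇒Nonempty ∣S∣≡1+k)
    with b , enum@(_ , _ , into) , sorted
           ← sortedEnumeration-of-size k (suc-injective (trans (sym (x∈p⇒∣p∣≡1+∣p-x∣ m∈S)) ∣S∣≡1+k))
                                         (TotalOn-remove tot)
    = m Vector.∷ b , Enumeration-∷ m∈S enum , Sorted-∷ (λ j → m-lb (p─q⊆p _ _ (into j))) sorted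

  sortedEnumeration : ∀ {S} → TotalOn S → ∃ λ (b : Fin ∣ S ∣ → Fin n) → Enumeration S b × Sorted b
  sortedEnumeration = sortedEnumeration-of-size _ refl

module InducedQuadruples (G : Graph) where

  Adj-sym : ∀ {u v} → Adj G u v → Adj G v u
  Adj-sym {u} {v} = trans (Graph.sym G v u)

  Adj⇒≢ : ∀ {u v} → Adj G u v → u ≢ v
  Adj⇒≢ {u} uv refl with () ← trans (sym uv) (irrefl G u)

  separated : ∀ {u v w} → Adj G u w → ¬ Adj G v w → u ≢ v
  separated uw ¬vw refl = ¬vw uw

  adj? : ∀ u v → Dec (Adj G u v)
  adj? u v = adj G u v ≟ᵇ true

  quadruple : (a b c d : Vertex G) → Fin 4 → Vertex G
  quadruple a b c d = lookup (a ∷ b ∷ c ∷ d ∷ [])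

  quadruple-injective : ∀ {a b c d} → a ≢ b → a ≢ c → a ≢ d → b ≢ c → b ≢ d → c ≢ d →
                        Injective _≡_ _≡_ (quadruple a b c d)
  quadruple-injective a≢b a≢c a≢d b≢c b≢d c≢d = lookup-injective distinct _ _
    where
    distinct : Unique (_ ∷ _ ∷ _ ∷ _ ∷ [])
    distinct = (a≢b ∷ a≢c ∷ a≢d ∷ []) ∷ (b≢c ∷ b≢d ∷ []) ∷ (c≢d ∷ []) ∷ [] ∷ []

  inducedC4 : ∀ {a b c d} → Adj G a b → Adj G b c → Adj G c d → Adj G d a →
              ¬ Adj G a c → ¬ Adj G b d → a ≢ c → b ≢ d → HasInduced G (cycleAdj 3)
  inducedC4 {a} {b} {c} {d} ab bc cd da ¬ac ¬bd a≢c b≢d =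
    quadruple a b c d ,
    quadruple-injective (Adj⇒≢ ab) a≢c (Adj⇒≢ (Adj-sym da)) (Adj⇒≢ bc) b≢d (Adj⇒≢ cd) ,
    table
    where
    table : ∀ i j → adj G (quadruple a b c d i) (quadruple a b c d j) ≡ cycleAdj 3 i j
    table 0F 0F = irrefl G a
    table 0F 1F = ab
    table 0F 2F = ¬-not ¬ac
    table 0F 3F = Adj-sym da
    table 1F 0F = Adj-sym ab
    table 1F 1F = irrefl G b
    table 1F 2F = bc
    table 1F 3F = ¬-not ¬bd
    table 2F 0F = ¬-not (¬ac ∘ Adj-sym)
    table 2F 1F = Adj-sym bc
    table 2F 2F = irrefl G c
    table 2F 3F = cd
    table 3F 0F = da
    table 3F 1F = ¬-not (¬bd ∘ Adj-sym)
    table 3F 2F = Adj-sym cd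
    table 3F 3F = irrefl G d

  inducedP4 : ∀ {a b c d} → Adj G a b → Adj G b c → Adj G c d →
              ¬ Adj G a c → ¬ Adj G b d → ¬ Adj G a d → InducedP4On G a b c d
  inducedP4 {a} {b} {c} {d} ab bc cd ¬ac ¬bd ¬ad =
    quadruple a b c d ,
    (quadruple-injective (Adj⇒≢ ab) (separated cd ¬ad ∘ sym)
                         (separated ab (¬bd ∘ Adj-sym)) (Adj⇒≢ bc)
                         (separated (Adj-sym ab) (¬ad ∘ Adj-sym)) (Adj⇒≢ cd) ,
     table) ,
    image
    where
    table : ∀ i j → adj G (quadruple a b c d i) (quadruple a b c d j) ≡ pathAdj 4 i j
    table 0F 0F = irrefl G a
    table 0F 1F = ab
    table 0F 2F = ¬-not ¬ac
    table 0F 3F = ¬-not ¬ad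
    table 1F 0F = Adj-sym ab
    table 1F 1F = irrefl G b
    table 1F 2F = bc
    table 1F 3F = ¬-not ¬bd
    table 2F 0F = ¬-not (¬ac ∘ Adj-sym)
    table 2F 1F = Adj-sym bc
    table 2F 2F = irrefl G c
    table 2F 3F = cd
    table 3F 0F = ¬-not (¬ad ∘ Adj-sym)
    table 3F 1F = ¬-not (¬bd ∘ Adj-sym)
    table 3F 2F = Adj-sym cd
    table 3F 3F = irrefl G d

    image : ∀ t → let v = quadruple a b c d t in v ≡ a ⊎ v ≡ b ⊎ v ≡ c ⊎ v ≡ d
    image 0F = inj₁ refl
    image 1F = inj₂ (inj₁ refl)
    image 2F = inj₂ (inj₂ (inj₁ refl))
    image 3F = inj₂ (inj₂ (inj₂ refl))

next-prev : ∀ i → next (prev i) ≡ i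
next-prev 0F = refl
next-prev 1F = refl
next-prev 2F = refl
next-prev 3F = refl
next-prev 4F = refl

prev-next : ∀ i → prev (next i) ≡ i
prev-next 0F = refl
prev-next 1F = refl
prev-next 2F = refl
prev-next 3F = refl
prev-next 4F = refl

next≢ : ∀ i → next i ≢ i
next≢ 0F ()
next≢ 1F ()
next≢ 2F ()
next≢ 3F ()
next≢ 4F ()

prev≢ : ∀ i → prev i ≢ i
prev≢ i prev≡ = next≢ (prev i) (trans (next-prev i) (sym prev≡))

module NiceBlowupProperties (G : Graph) (C4-free : Free G C4)
                            (B : Fin 5 → Subset (n G)) (nice : NiceBlowup G B) where
  open InducedQuadruples G
  open NiceBlowup nice

  _⊑[_]_ : Vertex G → Fin 5 → Vertex G → Set
  u ⊑[ i ] v = ∀ w → InNbrs G B i w → Adj G u w → Adj G v w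

  ⊑-refl : ∀ {i} → Reflexive _⊑[ i ]_
  ⊑-refl _ _ uw = uw

  ⊑-trans : ∀ {i} → Transitive _⊑[ i ]_
  ⊑-trans u⊑v v⊑x w w∈ uw = v⊑x w w∈ (u⊑v w w∈ uw)

  ≢-across : ∀ {i j u v} → i ≢ j → u ∈ B i → v ∈ B j → u ≢ v
  ≢-across i≢j u∈ v∈ refl = disjoint _ _ i≢j _ u∈ v∈

  exclusive-neighbours-same-side : ∀ {i j u v w w′} → j ≢ i →
    u ∈ B i → v ∈ B i → w ∈ B j → w′ ∈ B j →
    Adj G u w → ¬ Adj G v w → Adj G v w′ → ¬ Adj G u w′ → ⊥
  exclusive-neighbours-same-side {u = u} {v} {w} {w′} j≢i u∈ v∈ w∈ w′∈ uw ¬vw vw′ ¬uw′ =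
    C4-free (inducedC4 uw ww′ (Adj-sym vw′) vu ¬uw′ (¬vw ∘ Adj-sym)
                       (≢-across (j≢i ∘ sym) u∈ w′∈) (≢-across j≢i w∈ v∈))
    where
    ww′ : Adj G w w′
    ww′ = clique _ _ _ w∈ w′∈ (separated (Adj-sym uw) (¬uw′ ∘ Adj-sym))
    vu : Adj G v u
    vu = clique _ _ _ v∈ u∈ (separated vw′ ¬uw′)

  exclusive-neighbours-opposite-sides : ∀ {i a u v d} →
    a ∈ B (prev i) → u ∈ B i → v ∈ B i → d ∈ B (next i) →
    Adj G a u → ¬ Adj G a v → Adj G v d → ¬ Adj G u d → ⊥
  exclusive-neighbours-opposite-sides {i} {u = u} {v} {d} a∈ u∈ v∈ d∈ au ¬av vd ¬ud =
    noP4 (prev i) _ _ _ _ a∈ (shift u∈) (shift v∈) u≢v d∈′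
         (inducedP4 au (clique _ _ _ u∈ v∈ u≢v) vd ¬av ¬ud (noEdge (prev i) _ _ a∈ d∈′))
    where
    shift : ∀ {x} → x ∈ B i → x ∈ B (next (prev i))
    shift = subst (λ j → _ ∈ B j) (sym (next-prev i))
    d∈′ : d ∈ B (next (next (prev i)))
    d∈′ = subst (λ j → _ ∈ B j) (sym (cong next (next-prev i))) d∈
    u≢v : u ≢ v
    u≢v = separated (Adj-sym au) (¬av ∘ Adj-sym)

  no-exclusive-neighbours : ∀ {i u v w w′} → u ∈ B i → v ∈ B i →
    InNbrs G B i w → InNbrs G B i w′ →
    Adj G u w → ¬ Adj G v w → Adj G v w′ → ¬ Adj G u w′ → ⊥
  no-exclusive-neighbours {i} u∈ v∈ (inj₁ w∈) (inj₁ w′∈) =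
    exclusive-neighbours-same-side (prev≢ i) u∈ v∈ w∈ w′∈
  no-exclusive-neighbours {i} u∈ v∈ (inj₂ w∈) (inj₂ w′∈) =
    exclusive-neighbours-same-side (next≢ i) u∈ v∈ w∈ w′∈
  no-exclusive-neighbours u∈ v∈ (inj₁ w∈) (inj₂ w′∈) uw ¬vw vw′ ¬uw′ =
    exclusive-neighbours-opposite-sides w∈ u∈ v∈ w′∈ (Adj-sym uw) (¬vw ∘ Adj-sym) vw′ ¬uw′
  no-exclusive-neighbours u∈ v∈ (inj₂ w∈) (inj₁ w′∈) uw ¬vw vw′ ¬uw′ =
    exclusive-neighbours-opposite-sides w′∈ v∈ u∈ w∈ (Adj-sym vw′) (¬uw′ ∘ Adj-sym) uw ¬vw

  InNbrs? : ∀ i w → Dec (InNbrs G B i w)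
  InNbrs? i w = (w ∈? B (prev i)) ⊎-dec (w ∈? B (next i))

  ⊑-total : ∀ {i u v} → u ∈ B i → v ∈ B i → u ⊑[ i ] v ⊎ v ⊑[ i ] u
  ⊑-total {i} {u} {v} u∈ v∈ with any? (λ w → InNbrs? i w ×-dec adj? v w ×-dec ¬? (adj? u w))
  ... | yes (w′ , w′∈ , vw′ , ¬uw′) = inj₁ λ w w∈ uw → decidable-stable (adj? v w) λ ¬vw →
          no-exclusive-neighbours u∈ v∈ w∈ w′∈ uw ¬vw vw′ ¬uw′
  ... | no ∄w′ = inj₂ λ w′ w′∈ vw′ → decidable-stable (adj? u w′) λ ¬uw′ →
          ∄w′ (w′ , w′∈ , vw′ , ¬uw′)

  module ⊑-Order    (i : Fin 5) = PreorderOnSubset (_⊑[ i ]_)      ⊑-refl ⊑-trans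
  module ⊑-Reversed (i : Fin 5) = PreorderOnSubset (flip _⊑[ i ]_) ⊑-refl (flip ⊑-trans)

  has-neighbour-in : ∀ {i u} → InNbrs G B i u → ∃ λ y → y ∈ B i × Adj G y u
  has-neighbour-in {i} (inj₁ u∈) with y , y∈ , uy ← nbrNext (prev i) _ u∈ =
    y , subst (λ j → y ∈ B j) (next-prev i) y∈ , Adj-sym uy
  has-neighbour-in {i} (inj₂ u∈) with y , y∈ , uy ← nbrPrev (next i) _ u∈ =
    y , subst (λ j → y ∈ B j) (prev-next i) y∈ , Adj-sym uy

  sorted-ordering : ∀ i → ∃ λ (b : Fin ∣ B i ∣ → Vertex G) →
                    IsOrdering G (B i) b × (∀ j k → j ≤ k → b j ⊑[ i ] b k)
  sorted-ordering i = ⊑-Order.sortedEnumeration i ⊑-total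

  dominating-vertex : ∀ i → ∃ λ v → v ∈ B i × (∀ u → InNbrs G B i u → Adj G v u)
  dominating-vertex i
    with v , v∈ , v-greatest ← ⊑-Reversed.least i (λ x∈ y∈ → swap (⊑-total x∈ y∈)) (nonempty i) =
    v , v∈ , λ u u∈ → let y , y∈ , yu = has-neighbour-in u∈ in v-greatest y∈ u u∈ yu

lemma4p1 : (G : Graph) → Free G P7 → Free G C4 → Free G C6 →
    (B : Fin 5 → Subset (n G)) → NiceBlowup G B →
    (∀ i → ∃ λ (b : Fin ∣ B i ∣ → Vertex G) → IsOrdering G (B i) b ×
        (∀ j k → j ≤ k → ∀ u → InNbrs G B i u → Adj G (b j) u → Adj G (b k) u))
    × (∀ i → ∃ λ v → v ∈ B i × (∀ u → InNbrs G B i u → Adj G v u))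
    × (∀ i x y → x ∈ B (prev i) → y ∈ B (next i) →
        ∃ λ v → v ∈ B i × Adj G v x × Adj G v y)
lemma4p1 G _ C4-free _ B nice = sorted-ordering , dominating-vertex , common-neighbour
  where
  open NiceBlowupProperties G C4-free B nice

  common-neighbour : ∀ i x y → x ∈ B (prev i) → y ∈ B (next i) →
                     ∃ λ v → v ∈ B i × Adj G v x × Adj G v y
  common-neighbour i x y x∈ y∈ with v , v∈ , v-dominates ← dominating-vertex i =
    v , v∈ , v-dominates x (inj₁ x∈) , v-dominates y (inj₂ y∈)
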